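{- For every integer $k\geq 2$ there exist bipartite graphs $G$ with minimum degree $\delta(G)\geq k^2-k-1$ which are not $\frac{1}{k}$-majority $(k+1)$-edge-colourable.
   Context: Graphs are finite and simple. For an integer $k\geq 2$, a $\frac{1}{k}$-majority $l$-edge-colouring of a graph $G$ is an assignment to each edge of $G$ of one of $l$ colours such that for every colour $i$ and every vertex $v$ of $G$, at most $\frac{d_G(v)}{k}$ of the edges incident with $v$ have colour $i$ (where $d_G(v)$ is the degree of $v$). $G$ is $\frac{1}{k}$-majority $l$-edge-colourable if such a colouring exists. -}

module Defs where

open import Data.Nat using (ℕ; _+_; _*_; _≤_)
open import Data.Bool using (Bool; true; false; _∧_)
open import Data.Fin using (Fin)
open import Data.Fin.Properties using (_≟_)
open import Data.List using (List; filter; length; allFin)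
open import Data.Product using (Σ; _×_; ∃; _,_)
open import Relation.Nullary.Decidable using (⌊_⌋)
open import Relation.Binary.PropositionalEquality using (_≡_; _≢_)

record Graph : Set where
  field
    n     : ℕ
    adj   : Fin n → Fin n → Bool
    sym   : ∀ u v → adj u v ≡ adj v u
    irrefl : ∀ v → adj v v ≡ false
open Graph public

nbrs : (G : Graph) → Fin (n G) → List (Fin (n G))
nbrs G v = filter (λ u → adj G v u Data.Bool.≟ true) (allFin (n G))

degree : (G : Graph) → Fin (n G) → ℕ
degree G v = length (nbrs G v)

MinDegreeAtLeast : Graph → ℕ → Set
MinDegreeAtLeast G d = ∀ v → d ≤ degree G v

Bipartite : Graph → Set
Bipartite G = Σ (Fin (n G) → Bool) λ side →
  ∀ u v → adj G u v ≡ true → side u ≢ side v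

-- An l-edge-colouring: a colour for every (ordered) pair, symmetric, so that
-- each edge uv gets a single colour c u v = c v u (values on non-edges are irrelevant).
EdgeColouring : Graph → ℕ → Set
EdgeColouring G l = Σ (Fin (n G) → Fin (n G) → Fin l) λ c →
  ∀ u v → adj G u v ≡ true → c u v ≡ c v u

colourDegree : (G : Graph) {l : ℕ} → (Fin (n G) → Fin (n G) → Fin l) →
               Fin (n G) → Fin l → ℕ
colourDegree G c v i = length (filter (λ u → c v u ≟ i) (nbrs G v))

-- 1/k-majority: for every colour i and vertex v, #(edges at v of colour i) ≤ d(v)/k,
-- written without division as k * #(...) ≤ d(v).
IsMajorityColouring : (G : Graph) (k l : ℕ) → EdgeColouring G l → Set
IsMajorityColouring G k l (c , _) =
  ∀ (v : Fin (n G)) (i : Fin l) → k * colourDegree G c v i ≤ degree G v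

MajorityColourable : (G : Graph) (k l : ℕ) → Set
MajorityColourable G k l = Σ (EdgeColouring G l) (IsMajorityColouring G k l)

-- In a d-regular graph coloured with l colours so that every colour class at a
-- vertex has at most d/k edges, counting the edges at one vertex gives
-- d ≤ l ⌊d/k⌋. For d = k² − k − 1 we have ⌊d/k⌋ = k − 2 and (k + 1)(k − 2) = d − 1,
-- so no 1/k-majority (k + 1)-edge-colouring exists; the complete bipartite
-- graph K_{d,d} is such a d-regular bipartite graph.
module Submission where

open import Defs
open import Data.Nat using (ℕ; _≤_; _*_; _∸_; suc)
open import Data.Product using (Σ; _×_)
open import Relation.Nullary using (¬_)

open import Data.Bool as Bool using (Bool; true; false; _xor_; if_then_else_)
open import Data.Bool.Properties using (xor-same; xor-comm)
open import Data.Fin as Fin using (Fin; toℕ; zero; suc)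
open import Data.List using (List; []; _∷_; filter; length; tabulate)
open import Data.Nat using (zero; _+_; _<_; NonZero; z≤n; s≤s; s≤s⁻¹)
open import Data.Nat.DivMod using (_/_; m*n/n≡m; /-monoˡ-≤; m<n*o⇒m/o<n)
open import Data.Nat.Properties
open import Algebra.Properties.CommutativeMonoid.Sum +-0-commutativeMonoid
  using (sum-replicate-zero; sum-cong-≗; ∑-distrib-+; sum-syntax)
open import Data.Nat.Solver using (module +-*-Solver)
open import Data.Product using (_,_)
open import Function using (_∘_)
open import Relation.Nullary using (does)
open import Relation.Binary.PropositionalEquality
  using (_≡_; _≢_; refl; cong; cong₂; trans; subst; module ≡-Reasoning)
  renaming (sym to ≡-sym)
open +-*-Solver using (solve; _:+_; _:*_; _:=_; con)

∑-indicator : ∀ {l} (j : Fin l) → ∑[ i < l ] (if does (j Fin.≟ i) then 1 else 0) ≡ 1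
∑-indicator {suc l} zero    = cong suc (sum-replicate-zero l)
∑-indicator         (suc j) = ∑-indicator j

∑-≤-* : ∀ {l b} (f : Fin l → ℕ) → (∀ i → f i ≤ b) → ∑[ i < l ] f i ≤ l * b
∑-≤-* {zero}  f f≤b = z≤n
∑-≤-* {suc l} f f≤b = +-mono-≤ (f≤b zero) (∑-≤-* (f ∘ suc) (f≤b ∘ suc))

colourClass : ∀ {X : Set} {l} → (X → Fin l) → Fin l → List X → List X
colourClass f i = filter (λ x → f x Fin.≟ i)

length≡∑-colourClass : ∀ {X : Set} {l} (f : X → Fin l) (xs : List X) →
  length xs ≡ ∑[ i < l ] length (colourClass f i xs)
length≡∑-colourClass {l = l} f []       = ≡-sym (sum-replicate-zero l)
length≡∑-colourClass {l = l} f (x ∷ xs) = begin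
  suc (length xs)
    ≡⟨ cong₂ _+_ (≡-sym (∑-indicator (f x))) (length≡∑-colourClass f xs) ⟩
  ∑[ i < l ] δ i + ∑[ i < l ] length (colourClass f i xs)
    ≡⟨ ∑-distrib-+ δ (λ i → length (colourClass f i xs)) ⟨
  ∑[ i < l ] (δ i + length (colourClass f i xs))
    ≡⟨ sum-cong-≗ length-colourClass-∷ ⟩
  ∑[ i < l ] length (colourClass f i (x ∷ xs)) ∎
  where
  open ≡-Reasoning
  δ : Fin l → ℕ
  δ i = if does (f x Fin.≟ i) then 1 else 0
  length-colourClass-∷ : ∀ i → δ i + length (colourClass f i xs) ≡ length (colourClass f i (x ∷ xs))
  length-colourClass-∷ i with does (f x Fin.≟ i)
  ... | true  = refl
  ... | false = refl

length≤-colourClass : ∀ {X : Set} {l b} (f : X → Fin l) (xs : List X) →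
  (∀ i → length (colourClass f i xs) ≤ b) → length xs ≤ l * b
length≤-colourClass f xs bounded =
  ≤-trans (≤-reflexive (length≡∑-colourClass f xs)) (∑-≤-* _ bounded)

k*c≤d⇒c≤d/k : ∀ {k c d} .{{_ : NonZero k}} → k * c ≤ d → c ≤ d / k
k*c≤d⇒c≤d/k {k} {c} {d} k*c≤d = begin
  c             ≡⟨ m*n/n≡m c k ⟨
  c * k / k     ≤⟨ /-monoˡ-≤ k (≤-trans (≤-reflexive (*-comm c k)) k*c≤d) ⟩
  d / k         ∎
  where open ≤-Reasoning

majorityColourable⇒degree≤ : ∀ G k l .{{_ : NonZero k}} → MajorityColourable G k l →
  ∀ v → degree G v ≤ l * (degree G v / k)
majorityColourable⇒degree≤ G k l ((c , _) , majority) v =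
  length≤-colourClass (c v) (nbrs G v) (λ i → k*c≤d⇒c≤d/k (majority v i))

parity : ℕ → Bool
parity zero          = false
parity (suc zero)    = true
parity (suc (suc m)) = parity m

double : ℕ → ℕ
double zero    = zero
double (suc d) = suc (suc (double d))

length-filter-parity : ∀ {X : Set} d b (f : Fin (double d) → X) (p : X → Bool) →
  (∀ i → p (f i) ≡ b xor parity (toℕ i)) →
  length (filter (λ x → p x Bool.≟ true) (tabulate f)) ≡ d
length-filter-parity zero    b f p alternates = refl
length-filter-parity (suc d) true f p alternates rewrite alternates zero | alternates (suc zero) =
  cong suc (length-filter-parity d true (λ i → f (suc (suc i))) p (λ i → alternates (suc (suc i))))
length-filter-parity (suc d) false f p alternates rewrite alternates zero | alternates (suc zero) =
  cong suc (length-filter-parity d false (λ i → f (suc (suc i))) p (λ i → alternates (suc (suc i))))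

-- K_{d,d} on Fin (2d), the two sides being the even and the odd indices.
completeBipartite : ℕ → Graph
completeBipartite d = record
  { n      = double d
  ; adj    = λ u v → parity (toℕ u) xor parity (toℕ v)
  ; sym    = λ u v → xor-comm (parity (toℕ u)) (parity (toℕ v))
  ; irrefl = λ v → xor-same (parity (toℕ v))
  }

xor≡true⇒≢ : ∀ {x y} → x xor y ≡ true → x ≢ y
xor≡true⇒≢ {true}  () refl
xor≡true⇒≢ {false} () refl

completeBipartite-bipartite : ∀ d → Bipartite (completeBipartite d)
completeBipartite-bipartite d = (λ u → parity (toℕ u)) , λ u v → xor≡true⇒≢

degree-completeBipartite : ∀ d v → degree (completeBipartite d) v ≡ d
degree-completeBipartite d v =
  length-filter-parity d (parity (toℕ v)) (λ u → u) _ (λ u → refl)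

k*k∸k∸1≡ : ∀ m → (let k = 2 + m) → k * k ∸ k ∸ 1 ≡ suc (m * m + 3 * m)
k*k∸k∸1≡ m = begin
  (2 + m) * (2 + m) ∸ (2 + m) ∸ 1
    ≡⟨ cong (λ x → x ∸ (2 + m) ∸ 1) square ⟩
  suc (m * m + 3 * m) + 1 + (2 + m) ∸ (2 + m) ∸ 1
    ≡⟨ cong (_∸ 1) (m+n∸n≡m (suc (m * m + 3 * m) + 1) (2 + m)) ⟩
  suc (m * m + 3 * m) + 1 ∸ 1
    ≡⟨ m+n∸n≡m (suc (m * m + 3 * m)) 1 ⟩
  suc (m * m + 3 * m) ∎
  where
  open ≡-Reasoning
  square : (2 + m) * (2 + m) ≡ suc (m * m + 3 * m) + 1 + (2 + m)
  square = solve 1 (λ m → (con 2 :+ m) :* (con 2 :+ m)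
                        := con 1 :+ (m :* m :+ con 3 :* m) :+ con 1 :+ (con 2 :+ m)) refl m

[1+k][d/k]<d : ∀ m → (let k = 2 + m; d = suc (m * m + 3 * m)) → suc k * (d / k) < d
[1+k][d/k]<d m = begin-strict
  (3 + m) * (d / (2 + m))  ≤⟨ *-monoʳ-≤ (3 + m) d/k≤m ⟩
  (3 + m) * m              ≡⟨ solve 1 (λ m → (con 3 :+ m) :* m := m :* m :+ con 3 :* m) refl m ⟩
  m * m + 3 * m            <⟨ n<1+n _ ⟩
  d                        ∎
  where
  open ≤-Reasoning
  d = suc (m * m + 3 * m)
  d/k≤m : d / (2 + m) ≤ m
  d/k≤m = s≤s⁻¹ (m<n*o⇒m/o<n (≤-reflexive (solve 1 (λ m → con 2 :+ (m :* m :+ con 3 :* m)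
                                                   := (con 1 :+ m) :* (con 2 :+ m)) refl m)))

mainTheorem1 : (k : ℕ) → 2 ≤ k →
    Σ Graph λ G → Bipartite G × MinDegreeAtLeast G (k * k ∸ k ∸ 1) × ¬ MajorityColourable G k (suc k)
mainTheorem1 k@(suc (suc m)) (s≤s (s≤s z≤n)) =
  completeBipartite d , completeBipartite-bipartite d , k*k∸k∸1≤degree , not-colourable
  where
  d = suc (m * m + 3 * m)
  k*k∸k∸1≤degree : MinDegreeAtLeast (completeBipartite d) (k * k ∸ k ∸ 1)
  k*k∸k∸1≤degree v = ≤-reflexive (trans (k*k∸k∸1≡ m) (≡-sym (degree-completeBipartite d v)))
  not-colourable : ¬ MajorityColourable (completeBipartite d) k (suc k)
  not-colourable colouring = <⇒≱ ([1+k][d/k]<d m)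
    (subst (λ x → x ≤ suc k * (x / k)) (degree-completeBipartite d zero)
           (majorityColourable⇒degree≤ (completeBipartite d) k (suc k) colouring zero))
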